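{- If $H\in\{K_3,\overline{K_3},K_{1,2},\overline{K_{1,2}}\}$, then for every positive integer $n$, $$\mathrm{Dist}(n,\mathrm{Forb}(n,H))=\binom{\lceil n/2\rceil}{2}+\binom{\lfloor n/2\rfloor}{2}.$$
   Context: An edge-operation is the deletion of an existing edge or the addition of a non-existing edge. For an $n$-vertex graph $G$ and a family $\mathcal H$ of $n$-vertex graphs, $\mathrm{Dist}(G,\mathcal H)$ is the minimum of $|E(G)\,\Delta\,E(G')|$ over graphs $G'$ on vertex set $V(G)$ isomorphic to a member of $\mathcal H$, and $\mathrm{Dist}(n,\mathcal H)=\max\{\mathrm{Dist}(G,\mathcal H):|V(G)|=n\}$. $\mathrm{Forb}(n,H)$ is the set of $n$-vertex graphs with no induced subgraph isomorphic to $H$. $\overline{G}$ denotes the complement of $G$. -}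

module Defs where

open import Data.Nat using (ℕ; _<ᵇ_; _+_; _≤_; _≥_)
open import Data.Bool using (Bool; true; false; if_then_else_; _∧_; _xor_)
open import Data.Fin using (Fin; toℕ; zero; suc)
open import Data.Fin.Permutation using (Permutation′; _⟨$⟩ʳ_)
open import Data.List using (List; map; allFin)
open import Data.Nat.ListAction using (sum)
open import Data.Product using (Σ; ∃; _×_; _,_)
open import Relation.Binary.PropositionalEquality using (_≡_; refl)
open import Relation.Nullary using (¬_)
open import Function.Definitions using (Injective)

record Graph (n : ℕ) : Set where
  field
    adj    : Fin n → Fin n → Bool
    sym    : ∀ i j → adj i j ≡ adj j i
    irrefl : ∀ i → adj i i ≡ false
open Graph public

_≅_ : ∀ {n} → Graph n → Graph n → Set
_≅_ {n} G F = Σ (Permutation′ n) λ σ → ∀ i j → adj G (σ ⟨$⟩ʳ i) (σ ⟨$⟩ʳ j) ≡ adj F i j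

HasInduced : ∀ {n k} → Graph n → Graph k → Set
HasInduced {n} {k} G H =
  Σ (Fin k → Fin n) λ f → Injective _≡_ _≡_ f × (∀ i j → adj G (f i) (f j) ≡ adj H i j)

Forb : ∀ (n : ℕ) {k} → Graph k → Graph n → Set
Forb n H G = ¬ HasInduced G H

symDiff : ∀ {n} → Graph n → Graph n → ℕ
symDiff {n} G G' =
  sum (map (λ i → sum (map (λ j →
    if (toℕ i <ᵇ toℕ j) ∧ (adj G i j xor adj G' i j) then 1 else 0)
    (allFin n))) (allFin n))

-- Dist(G, 𝓗) for a family 𝓗 of n-vertex graphs (predicate):
-- the set of candidate G' are graphs on V(G) isomorphic to a member of 𝓗.
IsoToMember : ∀ {n} → (Graph n → Set) → Graph n → Set
IsoToMember {n} 𝓗 G' = Σ (Graph n) λ F → 𝓗 F × (G' ≅ F)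

DistIs : ∀ {n} → Graph n → (Graph n → Set) → ℕ → Set
DistIs {n} G 𝓗 d =
  (Σ (Graph n) λ G' → IsoToMember 𝓗 G' × symDiff G G' ≡ d)
  × (∀ G' → IsoToMember 𝓗 G' → d ≤ symDiff G G')

DistNIs : ∀ n → (Graph n → Set) → ℕ → Set
DistNIs n 𝓗 d =
  (Σ (Graph n) λ G → DistIs G 𝓗 d)
  × (∀ G → Σ ℕ λ e → DistIs G 𝓗 e × e ≤ d)

data SmallH : Set where
  K3 coK3 K12 coK12 : SmallH

adjOf : SmallH → Fin 3 → Fin 3 → Bool
adjOf K3 zero zero = false
adjOf K3 (suc zero) (suc zero) = false
adjOf K3 (suc (suc zero)) (suc (suc zero)) = false
adjOf K3 _ _ = true
adjOf coK3 _ _ = false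
adjOf K12 zero (suc _) = true
adjOf K12 (suc _) zero = true
adjOf K12 _ _ = false
adjOf coK12 (suc zero) (suc (suc zero)) = true
adjOf coK12 (suc (suc zero)) (suc zero) = true
adjOf coK12 _ _ = false

graphOf : SmallH → Graph 3
graphOf h = record { adj = adjOf h ; sym = s h ; irrefl = ir h }
  where
  s : ∀ h i j → adjOf h i j ≡ adjOf h j i
  s K3 zero zero = refl
  s K3 zero (suc zero) = refl
  s K3 zero (suc (suc zero)) = refl
  s K3 (suc zero) zero = refl
  s K3 (suc zero) (suc zero) = refl
  s K3 (suc zero) (suc (suc zero)) = refl
  s K3 (suc (suc zero)) zero = refl
  s K3 (suc (suc zero)) (suc zero) = refl
  s K3 (suc (suc zero)) (suc (suc zero)) = refl
  s coK3 i j = refl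
  s K12 zero zero = refl
  s K12 zero (suc j) = refl
  s K12 (suc i) zero = refl
  s K12 (suc i) (suc j) = refl
  s coK12 zero zero = refl
  s coK12 zero (suc zero) = refl
  s coK12 zero (suc (suc zero)) = refl
  s coK12 (suc zero) zero = refl
  s coK12 (suc zero) (suc zero) = refl
  s coK12 (suc zero) (suc (suc zero)) = refl
  s coK12 (suc (suc zero)) zero = refl
  s coK12 (suc (suc zero)) (suc zero) = refl
  s coK12 (suc (suc zero)) (suc (suc zero)) = refl
  ir : ∀ h i → adjOf h i i ≡ false
  ir K3 zero = refl
  ir K3 (suc zero) = refl
  ir K3 (suc (suc zero)) = refl
  ir coK3 i = refl
  ir K12 zero = refl
  ir K12 (suc i) = refl
  ir coK12 zero = refl
  ir coK12 (suc zero) = refl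
  ir coK12 (suc (suc zero)) = refl

module Submission where

-- The extremal graphs are the complete graph (for K₃), the balanced complete bipartite
-- graph (for K_{1,2}) and their complements: complementing both graphs preserves the
-- edit distance and turns H-free graphs into co-H-free ones, so only K₃ and K_{1,2} need
-- an argument. Both bounds peel off two vertices at a time, matching
-- D(n + 2) = n + D(n) for D(n) = C(⌈n/2⌉,2) + C(⌊n/2⌋,2).
--
-- Upper bound: a 2-colouring determines a K₃-free graph (the edges of G between the
-- colour classes) and a K_{1,2}-free graph (the two classes as cliques). Give two vertices
-- u, v colours for which the pair uv costs nothing; over the two such choices each of
-- the n other vertices is charged at most once at u and at most once at v, so the
-- cheaper choice costs at most n on top of the colouring of the rest.
--
-- Lower bound: in a triangle-free graph with an edge uv, each of the n other vertices is
-- non-adjacent to u or to v, giving n non-edges (Mantel). In a disjoint union of cliques,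
-- the ends of an edge uv across the bipartition of K_{⌈n/2⌉,⌊n/2⌋} are twins, so again
-- each other vertex disagrees with the bipartite graph at u or at v; if there is no such
-- edge, every pair across the bipartition is an edit.
--
-- Dist is a minimum over the finitely many graphs on Fin n, so it is attained.

open import Algebra.Properties.CommutativeSemigroup using (interchange)
open import Data.Bool as Bool using (Bool; true; false; not; _∧_; _∨_; _xor_; if_then_else_; T)
open import Data.Bool.Properties using (not-involutive; ∧-comm; ∧-idem; ∧-zeroʳ; xor-comm; xor-same)
open import Data.Empty using (⊥; ⊥-elim)
open import Data.Fin using (Fin; toℕ; zero; suc; _≟_; #_)
open import Data.Fin.Permutation as Permutation using (_⟨$⟩ˡ_; _⟨$⟩ʳ_; inverseʳ)
open import Data.Fin.Properties using (all?)
open import Data.List using (List; []; _∷_; _++_; map; allFin; length; cartesianProductWith; filter)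
open import Data.List.Extrema.Nat using (argmin; argmin-all; f[argmin]≤f[⊤]; f[argmin]≤f[xs])
open import Data.List.Membership.Propositional using (_∈_; find; lose)
open import Data.List.Membership.Propositional.Properties
  using (∈-∃++; ∈-allFin; ∈-cartesianProductWith⁺; ∈-filter⁺)
open import Data.List.Properties using (map-∘; map-tabulate; map-cong; length-tabulate)
open import Data.List.Relation.Binary.Permutation.Propositional as ↭ using (_↭_; ↭-trans; ↭⇒↭ₛ)
open import Data.List.Relation.Binary.Permutation.Propositional.Properties
  using (shift; ∈-resp-↭; ↭-length) renaming (map⁺ to ↭-map⁺)
import Data.List.Relation.Binary.Permutation.Setoid.Properties as ↭ₛ
open import Data.List.Relation.Unary.All as All using (All; []; _∷_)
open import Data.List.Relation.Unary.All.Properties using (all-filter)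
open import Data.List.Relation.Unary.AllPairs using ([]; _∷_)
open import Data.List.Relation.Unary.Any using (Any; here; there; any?)
open import Data.List.Relation.Unary.Unique.Propositional using (Unique)
open import Data.List.Relation.Unary.Unique.Propositional.Properties using (allFin⁺)
open import Data.Nat using (ℕ; zero; suc; _+_; _*_; _⊓_; _≤_; _≤?_; _<ᵇ_; z≤n; s≤s; ⌈_/2⌉; ⌊_/2⌋)
open import Data.Nat.Combinatorics using (_C_; nCk+nC[k+1]≡[n+1]C[k+1]; nC1≡n)
open import Data.Nat.ListAction using (sum)
open import Data.Nat.ListAction.Properties using (sum-↭)
open import Data.Nat.Properties
  using ( +-comm; +-assoc; +-suc; *-suc; ≤-refl; ≤-reflexive; ≤-trans; ≤-antisym; <⇒≤; ≰⇒>
        ; +-mono-≤; +-monoˡ-≤; +-cancelˡ-≤; +-cancelʳ-≤; m≤m+n; m≤n+m; suc-injective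
        ; ⌊n/2⌋+⌈n/2⌉≡n; ⌊n/2⌋≤⌈n/2⌉; m≥n⇒m⊓n≡n; +-commutativeSemigroup
        ; module ≤-Reasoning )
open import Data.Nat.Tactic.RingSolver using (solve-∀)
open import Data.Product as Product using (∃; _×_; _,_; proj₁; proj₂)
open import Data.Vec as Vec using (Vec; lookup; tabulate)
open import Data.Vec.Functional using () renaming (_∷_ to _◂_)
open import Data.Vec.Properties using (lookup∘tabulate)
open import Defs hiding (sym)
open import Function using (_∘_; id)
open import Relation.Binary.PropositionalEquality
  using (_≡_; _≢_; refl; sym; trans; cong; cong₂; subst; setoid; module ≡-Reasoning)
open import Relation.Nullary using (¬_; contradiction; Dec; yes; no; does)
open import Relation.Nullary.Decidable
  using (dec-true; dec-false; map′; _×-dec_; _→-dec_; ¬?; True; toWitness)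

private
  variable
    A B : Set
    n m : ℕ

suc*suc : ∀ a b → suc a * suc b ≡ suc ((a + b) + a * b)
suc*suc = solve-∀

pairsWithinHalves : ℕ → ℕ
pairsWithinHalves n = ⌈ n /2⌉ C 2 + ⌊ n /2⌋ C 2

[1+m]C2≡m+mC2 : ∀ m → suc m C 2 ≡ m + m C 2
[1+m]C2≡m+mC2 m = trans (sym (nCk+nC[k+1]≡[n+1]C[k+1] m 1)) (cong (_+ m C 2) (nC1≡n m))

⌈n/2⌉+⌊n/2⌋≡n : ∀ n → ⌈ n /2⌉ + ⌊ n /2⌋ ≡ n
⌈n/2⌉+⌊n/2⌋≡n n = trans (+-comm ⌈ n /2⌉ _) (⌊n/2⌋+⌈n/2⌉≡n n)

pairsWithinHalves-+2 : ∀ n → pairsWithinHalves (2 + n) ≡ n + pairsWithinHalves n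
pairsWithinHalves-+2 n = begin
  suc ⌈ n /2⌉ C 2 + suc ⌊ n /2⌋ C 2
    ≡⟨ cong₂ _+_ ([1+m]C2≡m+mC2 ⌈ n /2⌉) ([1+m]C2≡m+mC2 ⌊ n /2⌋) ⟩
  (⌈ n /2⌉ + ⌈ n /2⌉ C 2) + (⌊ n /2⌋ + ⌊ n /2⌋ C 2)
    ≡⟨ interchange +-commutativeSemigroup ⌈ n /2⌉ _ _ _ ⟩
  (⌈ n /2⌉ + ⌊ n /2⌋) + pairsWithinHalves n
    ≡⟨ cong (_+ pairsWithinHalves n) (⌈n/2⌉+⌊n/2⌋≡n n) ⟩
  n + pairsWithinHalves n
    ∎
  where open ≡-Reasoning

pairsWithinHalves+⌊n/2⌋ : ∀ n → pairsWithinHalves n + ⌊ n /2⌋ ≡ ⌈ n /2⌉ * ⌊ n /2⌋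
pairsWithinHalves+⌊n/2⌋ zero          = refl
pairsWithinHalves+⌊n/2⌋ (suc zero)    = refl
pairsWithinHalves+⌊n/2⌋ (suc (suc n)) = begin
  pairsWithinHalves (2 + n) + suc b
    ≡⟨ cong (_+ suc b) (pairsWithinHalves-+2 n) ⟩
  (n + pairsWithinHalves n) + suc b
    ≡⟨ cong (λ k → (k + pairsWithinHalves n) + suc b) (⌈n/2⌉+⌊n/2⌋≡n n) ⟨
  ((a + b) + pairsWithinHalves n) + suc b
    ≡⟨ regroup a b (pairsWithinHalves n) ⟩
  suc ((a + b) + (pairsWithinHalves n + b))
    ≡⟨ cong (λ k → suc ((a + b) + k)) (pairsWithinHalves+⌊n/2⌋ n) ⟩
  suc ((a + b) + a * b)
    ≡⟨ suc*suc a b ⟨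
  suc a * suc b
    ∎
  where
  open ≡-Reasoning
  a b : ℕ
  a = ⌈ n /2⌉
  b = ⌊ n /2⌋
  regroup : ∀ x y d → ((x + y) + d) + suc y ≡ suc ((x + y) + (d + y))
  regroup = solve-∀

-- Counting pairs in a list

[_] : Bool → ℕ
[ b ] = if b then 1 else 0

countᵇ : (A → Bool) → List A → ℕ
countᵇ f xs = sum (map (λ x → [ f x ]) xs)

pairCount : (A → A → Bool) → List A → ℕ
pairCount w []       = 0
pairCount w (x ∷ xs) = countᵇ (w x) xs + pairCount w xs

Symmetricᵇ : (A → A → Bool) → Set
Symmetricᵇ w = ∀ x y → w x y ≡ w y x

countᵇ-map : ∀ (f : B → Bool) (g : A → B) xs → countᵇ f (map g xs) ≡ countᵇ (f ∘ g) xs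
countᵇ-map f g xs = cong sum (sym (map-∘ xs))

pairCount-map : ∀ (w : B → B → Bool) (g : A → B) xs →
  pairCount w (map g xs) ≡ pairCount (λ x y → w (g x) (g y)) xs
pairCount-map w g []       = refl
pairCount-map w g (x ∷ xs) = cong₂ _+_ (countᵇ-map (w (g x)) g xs) (pairCount-map w g xs)

countᵇ-cong : ∀ {f g : A → Bool} {xs} → All (λ x → f x ≡ g x) xs → countᵇ f xs ≡ countᵇ g xs
countᵇ-cong []       = refl
countᵇ-cong (e ∷ es) = cong₂ _+_ (cong [_] e) (countᵇ-cong es)

pairCount-cong : ∀ {v w : A → A → Bool} {xs} → Unique xs →
  (∀ {x y} → x ≢ y → v x y ≡ w x y) → pairCount v xs ≡ pairCount w xs
pairCount-cong []             v≡w = refl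
pairCount-cong (x≢xs ∷ uniq) v≡w = cong₂ _+_ (countᵇ-cong (All.map v≡w x≢xs)) (pairCount-cong uniq v≡w)

[]-mono : ∀ {a b} → (T a → T b) → [ a ] ≤ [ b ]
[]-mono {false}        a⇒b = z≤n
[]-mono {true} {true}  a⇒b = ≤-refl
[]-mono {true} {false} a⇒b = ⊥-elim (a⇒b _)

countᵇ-mono : ∀ {f g : A → Bool} {xs} → All (λ x → T (f x) → T (g x)) xs →
  countᵇ f xs ≤ countᵇ g xs
countᵇ-mono []           = z≤n
countᵇ-mono (f⇒g ∷ f⇒gs) = +-mono-≤ ([]-mono f⇒g) (countᵇ-mono f⇒gs)

pairCount-mono : ∀ {v w : A → A → Bool} xs →
  (∀ {x y} → x ∈ xs → y ∈ xs → T (v x y) → T (w x y)) → pairCount v xs ≤ pairCount w xs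
pairCount-mono []       v⇒w = z≤n
pairCount-mono (x ∷ xs) v⇒w = +-mono-≤ (countᵇ-mono (All.tabulate (v⇒w (here refl) ∘ there)))
                                       (pairCount-mono xs λ x∈ y∈ → v⇒w (there x∈) (there y∈))

countᵇ+countᵇ-not : ∀ (f : A → Bool) xs → countᵇ f xs + countᵇ (not ∘ f) xs ≡ length xs
countᵇ+countᵇ-not f []       = refl
countᵇ+countᵇ-not f (x ∷ xs) with f x
... | true  = cong suc (countᵇ+countᵇ-not f xs)
... | false = trans (+-suc _ _) (cong suc (countᵇ+countᵇ-not f xs))

countᵇ+countᵇ≤length : ∀ {f g : A → Bool} → (∀ x → f x ∧ g x ≡ false) → ∀ xs →
  countᵇ f xs + countᵇ g xs ≤ length xs
countᵇ+countᵇ≤length f∧g≡false []                   = z≤n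
countᵇ+countᵇ≤length {f = f} {g} f∧g≡false (x ∷ xs) = begin
  ([ f x ] + countᵇ f xs) + ([ g x ] + countᵇ g xs)
    ≡⟨ interchange +-commutativeSemigroup [ f x ] _ _ _ ⟩
  ([ f x ] + [ g x ]) + (countᵇ f xs + countᵇ g xs)
    ≤⟨ +-mono-≤ (atMostOne (f x) (g x) (f∧g≡false x)) (countᵇ+countᵇ≤length f∧g≡false xs) ⟩
  suc (length xs)
    ∎
  where
  open ≤-Reasoning
  atMostOne : ∀ a b → a ∧ b ≡ false → [ a ] + [ b ] ≤ 1
  atMostOne true  false _ = ≤-refl
  atMostOne false true  _ = ≤-refl
  atMostOne false false _ = z≤n

length≤countᵇ+countᵇ : ∀ {f g : A → Bool} xs → All (λ x → T (f x ∨ g x)) xs →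
  length xs ≤ countᵇ f xs + countᵇ g xs
length≤countᵇ+countᵇ []       []                            = z≤n
length≤countᵇ+countᵇ {f = f} {g} (x ∷ xs) (fx∨gx ∷ f∨gs) = begin
  suc (length xs)
    ≤⟨ +-mono-≤ (atLeastOne (f x) (g x) fx∨gx) (length≤countᵇ+countᵇ xs f∨gs) ⟩
  ([ f x ] + [ g x ]) + (countᵇ f xs + countᵇ g xs)
    ≡⟨ interchange +-commutativeSemigroup [ f x ] _ _ _ ⟩
  ([ f x ] + countᵇ f xs) + ([ g x ] + countᵇ g xs)
    ∎
  where
  open ≤-Reasoning
  atLeastOne : ∀ a b → T (a ∨ b) → 1 ≤ [ a ] + [ b ]
  atLeastOne true  _    _ = s≤s z≤n
  atLeastOne false true _ = s≤s z≤n

pairCount-xor : ∀ (c : A → Bool) xs →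
  pairCount (λ x y → c x xor c y) xs ≡ countᵇ c xs * countᵇ (not ∘ c) xs
pairCount-xor c []       = refl
pairCount-xor c (x ∷ xs) with c x
... | true  = cong (countᵇ (not ∘ c) xs +_) (pairCount-xor c xs)
... | false = trans (cong (countᵇ c xs +_) (pairCount-xor c xs)) (sym (*-suc (countᵇ c xs) _))

countᵇ-↭ : ∀ (f : A → Bool) {xs ys} → xs ↭ ys → countᵇ f xs ≡ countᵇ f ys
countᵇ-↭ f xs↭ys = sum-↭ (↭-map⁺ _ xs↭ys)

pairCount-↭ : ∀ {w : A → A → Bool} → Symmetricᵇ w → ∀ {xs ys} → xs ↭ ys →
  pairCount w xs ≡ pairCount w ys
pairCount-↭ w-sym ↭.refl        = refl
pairCount-↭ w-sym (↭.prep x p)  = cong₂ _+_ (countᵇ-↭ _ p) (pairCount-↭ w-sym p)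
pairCount-↭ w-sym (↭.trans p q) = trans (pairCount-↭ w-sym p) (pairCount-↭ w-sym q)
pairCount-↭ {w = w} w-sym (↭.swap x y p)
  rewrite w-sym x y | countᵇ-↭ (w x) p | countᵇ-↭ (w y) p | pairCount-↭ w-sym p
  = interchange +-commutativeSemigroup [ w y x ] _ _ _

Unique-resp-↭ : ∀ {xs ys : List A} → xs ↭ ys → Unique xs → Unique ys
Unique-resp-↭ p = ↭ₛ.Unique-resp-↭ (setoid _) (↭⇒↭ₛ p)

∈⇒↭∷ : ∀ {x : A} {xs} → x ∈ xs → ∃ λ rest → xs ↭ x ∷ rest
∈⇒↭∷ {x = x} x∈xs with ys , zs , refl ← ∈-∃++ x∈xs = ys ++ zs , shift x ys zs

∈⇒↭∷∷ : ∀ {x y : A} {xs} → x ∈ xs → y ∈ xs → x ≢ y → ∃ λ rest → xs ↭ x ∷ y ∷ rest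
∈⇒↭∷∷ x∈xs y∈xs x≢y with rest , p ← ∈⇒↭∷ x∈xs with ∈-resp-↭ p y∈xs
... | here y≡x     = contradiction (sym y≡x) x≢y
... | there y∈rest with rest′ , q ← ∈⇒↭∷ y∈rest = rest′ , ↭-trans p (↭.prep _ q)

CoveringPair : (A → A → Bool) → List A → Set
CoveringPair w xs =
  ∃ λ u → ∃ λ v → ∃ λ rest → (xs ↭ u ∷ v ∷ rest) × All (λ j → T (w u j ∨ w v j)) rest

pairCount-peel : ∀ {w : A → A → Bool} → Symmetricᵇ w → ∀ {xs u v rest} → xs ↭ u ∷ v ∷ rest →
  All (λ j → T (w u j ∨ w v j)) rest → length rest + pairCount w rest ≤ pairCount w xs
pairCount-peel {w = w} w-sym {xs} {u} {v} {rest} p covered = begin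
  length rest + pairCount w rest
    ≤⟨ +-monoˡ-≤ _ (length≤countᵇ+countᵇ rest covered) ⟩
  (countᵇ (w u) rest + countᵇ (w v) rest) + pairCount w rest
    ≡⟨ +-assoc (countᵇ (w u) rest) _ _ ⟩
  countᵇ (w u) rest + (countᵇ (w v) rest + pairCount w rest)
    ≤⟨ m≤n+m _ [ w u v ] ⟩
  [ w u v ] + (countᵇ (w u) rest + (countᵇ (w v) rest + pairCount w rest))
    ≡⟨ +-assoc [ w u v ] _ _ ⟨
  pairCount w (u ∷ v ∷ rest)
    ≡⟨ pairCount-↭ w-sym p ⟨
  pairCount w xs
    ∎
  where open ≤-Reasoning

pairsWithinHalves≤pairCount : ∀ {w : A → A → Bool} → Symmetricᵇ w →
  (∀ {x y xs} → Unique (x ∷ y ∷ xs) → CoveringPair w (x ∷ y ∷ xs)) →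
  ∀ k {xs} → length xs ≡ k → Unique xs → pairsWithinHalves k ≤ pairCount w xs
pairsWithinHalves≤pairCount w-sym covering zero       _ _ = z≤n
pairsWithinHalves≤pairCount w-sym covering (suc zero) _ _ = z≤n
pairsWithinHalves≤pairCount {w = w} w-sym covering (suc (suc k)) {x ∷ y ∷ xs} len uniq
  with u , v , rest , p , covered ← covering uniq
  with _ ∷ _ ∷ uniq-rest ← Unique-resp-↭ p uniq = begin
  pairsWithinHalves (2 + k)
    ≡⟨ pairsWithinHalves-+2 k ⟩
  k + pairsWithinHalves k
    ≤⟨ +-mono-≤ (≤-reflexive (sym len-rest))
                (pairsWithinHalves≤pairCount w-sym covering k len-rest uniq-rest) ⟩
  length rest + pairCount w rest
    ≤⟨ pairCount-peel w-sym p covered ⟩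
  pairCount w (x ∷ y ∷ xs)
    ∎
  where
  open ≤-Reasoning
  len-rest : length rest ≡ k
  len-rest = suc-injective (suc-injective (trans (sym (↭-length p)) len))

sum-map-allFin-suc : ∀ (g : Fin (suc m) → ℕ) →
  sum (map g (allFin (suc m))) ≡ g zero + sum (map (g ∘ suc) (allFin m))
sum-map-allFin-suc g =
  cong (λ xs → g zero + sum xs) (trans (map-tabulate suc g) (sym (map-tabulate id (g ∘ suc))))

countᵇ-allFin-suc : ∀ (f : Fin (suc m) → Bool) →
  countᵇ f (allFin (suc m)) ≡ [ f zero ] + countᵇ (f ∘ suc) (allFin m)
countᵇ-allFin-suc f = sum-map-allFin-suc (λ x → [ f x ])

pairCount-allFin-suc : ∀ (w : Fin (suc m) → Fin (suc m) → Bool) →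
  pairCount w (allFin (suc m))
    ≡ countᵇ (w zero ∘ suc) (allFin m) + pairCount (λ i j → w (suc i) (suc j)) (allFin m)
pairCount-allFin-suc {m} w = trans (cong (pairCount w) allFin-suc)
  (cong₂ _+_ (countᵇ-map (w zero) suc (allFin m)) (pairCount-map w suc (allFin m)))
  where
  allFin-suc : allFin (suc m) ≡ zero ∷ map suc (allFin m)
  allFin-suc = cong (zero ∷_) (sym (map-tabulate id suc))

pairCount-allFin : ∀ n (w : Fin n → Fin n → Bool) →
  pairCount w (allFin n)
    ≡ sum (map (λ i → countᵇ (λ j → (toℕ i <ᵇ toℕ j) ∧ w i j) (allFin n)) (allFin n))
pairCount-allFin zero    w = refl
pairCount-allFin (suc m) w = begin
  pairCount w (allFin (suc m))
    ≡⟨ pairCount-allFin-suc w ⟩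
  countᵇ (w zero ∘ suc) (allFin m) + pairCount (λ i j → w (suc i) (suc j)) (allFin m)
    ≡⟨ cong (countᵇ (w zero ∘ suc) (allFin m) +_) (pairCount-allFin m _) ⟩
  countᵇ (row zero ∘ suc) (allFin m) + sum (map (λ i → countᵇ (row (suc i) ∘ suc) (allFin m)) (allFin m))
    ≡⟨ cong₂ _+_ (countᵇ-allFin-suc (row zero))
                 (cong sum (map-cong (countᵇ-allFin-suc ∘ row ∘ suc) (allFin m))) ⟨
  countᵇ (row zero) (allFin (suc m)) + sum (map (λ i → countᵇ (row (suc i)) (allFin (suc m))) (allFin m))
    ≡⟨ sum-map-allFin-suc (λ i → countᵇ (row i) (allFin (suc m))) ⟨
  sum (map (λ i → countᵇ (row i) (allFin (suc m))) (allFin (suc m)))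
    ∎
  where
  open ≡-Reasoning
  -- row zero ∘ suc and row (suc i) ∘ suc reduce to w zero ∘ suc and to the rows for m.
  row : Fin (suc m) → Fin (suc m) → Bool
  row i j = (toℕ i <ᵇ toℕ j) ∧ w i j

-- Graphs, complements and induced subgraphs

_≢ᵇ_ : Fin n → Fin n → Bool
i ≢ᵇ j = not (does (i ≟ j))

≢ᵇ-irrefl : ∀ (i : Fin n) → i ≢ᵇ i ≡ false
≢ᵇ-irrefl i = cong not (dec-true (i ≟ i) refl)

≢⇒≢ᵇ : ∀ {i j : Fin n} → i ≢ j → i ≢ᵇ j ≡ true
≢⇒≢ᵇ {i = i} {j} i≢j = cong not (dec-false (i ≟ j) i≢j)

≢⇒≢ᵇ∧b≡b : ∀ {i j : Fin n} {b} → i ≢ j → (i ≢ᵇ j) ∧ b ≡ b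
≢⇒≢ᵇ∧b≡b i≢j = cong (_∧ _) (≢⇒≢ᵇ i≢j)

≢ᵇ-sym : ∀ (i j : Fin n) → i ≢ᵇ j ≡ j ≢ᵇ i
≢ᵇ-sym i j with i ≟ j
... | yes refl = sym (≢ᵇ-irrefl i)
... | no  i≢j  = sym (≢⇒≢ᵇ (i≢j ∘ sym))

simpleGraph : (r : Fin n → Fin n → Bool) → Symmetricᵇ r → Graph n
simpleGraph r r-sym = record
  { adj    = λ i j → (i ≢ᵇ j) ∧ r i j
  ; sym    = λ i j → cong₂ _∧_ (≢ᵇ-sym i j) (r-sym i j)
  ; irrefl = λ i → cong (_∧ r i i) (≢ᵇ-irrefl i)
  }

completeGraph : Graph n
completeGraph = simpleGraph (λ _ _ → true) (λ _ _ → refl)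

complement : Graph n → Graph n
complement G = simpleGraph (λ i j → not (adj G i j)) (λ i j → cong not (Graph.sym G i j))

adj-complement : ∀ (G : Graph n) {i j} → i ≢ j → adj (complement G) i j ≡ not (adj G i j)
adj-complement G = ≢⇒≢ᵇ∧b≡b

adj≡true⇒≢ : ∀ (G : Graph n) {u v} → adj G u v ≡ true → u ≢ v
adj≡true⇒≢ G {u} uv refl with () ← trans (sym uv) (irrefl G u)

symDiff≡pairCount : ∀ (G G' : Graph n) {w} → (∀ {i j} → i ≢ j → (adj G i j xor adj G' i j) ≡ w i j) →
  symDiff G G' ≡ pairCount w (allFin n)
symDiff≡pairCount {n} G G' Δ≡w = trans (sym (pairCount-allFin n _)) (pairCount-cong (allFin⁺ n) Δ≡w)

symDiff-complement : ∀ (G G' : Graph n) → symDiff G (complement G') ≡ symDiff (complement G) G'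
symDiff-complement G G' = trans (symDiff≡pairCount G (complement G') left)
                                (sym (symDiff≡pairCount (complement G) G' right))
  where
  not-xor : ∀ a b → not a xor b ≡ a xor not b
  not-xor true  b = sym (not-involutive b)
  not-xor false b = refl
  left : ∀ {i j} → i ≢ j → (adj G i j xor adj (complement G') i j) ≡ adj G i j xor not (adj G' i j)
  left i≢j = cong (adj G _ _ xor_) (adj-complement G' i≢j)
  right : ∀ {i j} → i ≢ j → (adj (complement G) i j xor adj G' i j) ≡ adj G i j xor not (adj G' i j)
  right {i} {j} i≢j = trans (cong (_xor adj G' i j) (adj-complement G i≢j)) (not-xor (adj G i j) _)

HasInduced-resp-≗ : ∀ {G : Graph n} {H H' : Graph m} → (∀ i j → adj H i j ≡ adj H' i j) →
  HasInduced G H → HasInduced G H'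
HasInduced-resp-≗ H≗H' (f , f-inj , f-adj) = f , f-inj , λ i j → trans (f-adj i j) (H≗H' i j)

≅-HasInduced : ∀ {G F : Graph n} {H : Graph m} → G ≅ F → HasInduced G H → HasInduced F H
≅-HasInduced {n} {m} {G} {F} {H} (σ , σ-adj) (f , f-inj , f-adj) = g , g-inj , g-adj
  where
  g : Fin m → Fin n
  g i = σ ⟨$⟩ˡ f i
  g-inj : ∀ {i j} → g i ≡ g j → i ≡ j
  g-inj eq = f-inj (trans (sym (inverseʳ σ)) (trans (cong (σ ⟨$⟩ʳ_) eq) (inverseʳ σ)))
  g-adj : ∀ i j → adj F (g i) (g j) ≡ adj H i j
  g-adj i j = trans (sym (σ-adj (g i) (g j))) (trans (cong₂ (adj G) (inverseʳ σ) (inverseʳ σ)) (f-adj i j))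

Forb-closed : ∀ {G : Graph n} {H : Graph m} → IsoToMember (Forb n H) G → Forb n H G
Forb-closed {G = G} {H} (F , F-free , G≅F) = F-free ∘ ≅-HasInduced {G = G} {F} {H} G≅F

complement-HasInduced : ∀ {G : Graph n} {H : Graph m} →
  HasInduced (complement G) H → HasInduced G (complement H)
complement-HasInduced {G = G} {H} (f , f-inj , f-adj) = f , f-inj , g-adj
  where
  g-adj : ∀ i j → adj G (f i) (f j) ≡ adj (complement H) i j
  g-adj i j with i ≟ j
  ... | yes refl = irrefl G (f i)
  ... | no  i≢j  = begin
    adj G (f i) (f j)                     ≡⟨ not-involutive _ ⟨
    not (not (adj G (f i) (f j)))         ≡⟨ cong not (adj-complement G (i≢j ∘ f-inj)) ⟨
    not (adj (complement G) (f i) (f j))  ≡⟨ cong not (f-adj i j) ⟩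
    not (adj H i j)                       ∎
    where open ≡-Reasoning

vectors : List A → (k : ℕ) → List (Vec A k)
vectors xs zero    = Vec.[] ∷ []
vectors xs (suc k) = cartesianProductWith Vec._∷_ xs (vectors xs k)

∈-vectors : ∀ {xs : List A} → (∀ x → x ∈ xs) → ∀ {k} (v : Vec A k) → v ∈ vectors xs k
∈-vectors all∈ Vec.[]      = here refl
∈-vectors all∈ (x Vec.∷ v) = ∈-cartesianProductWith⁺ Vec._∷_ (all∈ x) (∈-vectors all∈ v)

hasInduced? : ∀ (G : Graph n) (H : Graph m) → Dec (HasInduced G H)
hasInduced? {n} {m} G H = map′ fromVector toVector (any? embeds? (vectors (allFin n) m))
  where
  Embeds : Vec (Fin n) m → Set
  Embeds v = (∀ i j → lookup v i ≡ lookup v j → i ≡ j)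
           × (∀ i j → adj G (lookup v i) (lookup v j) ≡ adj H i j)
  embeds? : ∀ v → Dec (Embeds v)
  embeds? v = (all? λ i → all? λ j → lookup v i ≟ lookup v j →-dec i ≟ j)
        ×-dec (all? λ i → all? λ j → adj G (lookup v i) (lookup v j) Bool.≟ adj H i j)
  fromVector : Any Embeds (vectors (allFin n) m) → HasInduced G H
  fromVector embedding with v , _ , v-inj , v-adj ← find embedding = lookup v , v-inj _ _ , v-adj
  toVector : HasInduced G H → Any Embeds (vectors (allFin n) m)
  toVector (f , f-inj , f-adj) = lose (∈-vectors ∈-allFin (tabulate f)) (v-inj , v-adj)
    where
    v-inj : ∀ i j → lookup (tabulate f) i ≡ lookup (tabulate f) j → i ≡ j
    v-inj i j rewrite lookup∘tabulate f i | lookup∘tabulate f j = f-inj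
    v-adj : ∀ i j → adj G (lookup (tabulate f) i) (lookup (tabulate f) j) ≡ adj H i j
    v-adj i j rewrite lookup∘tabulate f i | lookup∘tabulate f j = f-adj i j

induced-triple : ∀ (G : Graph n) (H : Graph 3) {x y z} → x ≢ y → x ≢ z → y ≢ z →
  adj G x y ≡ adj H (# 0) (# 1) → adj G x z ≡ adj H (# 0) (# 2) → adj G y z ≡ adj H (# 1) (# 2) →
  HasInduced G H
induced-triple {n} G H {x} {y} {z} x≢y x≢z y≢z xy xz yz = f , f-inj , f-adj
  where
  f : Fin 3 → Fin n
  f zero             = x
  f (suc zero)       = y
  f (suc (suc zero)) = z
  f-inj : ∀ {i j} → f i ≡ f j → i ≡ j
  f-inj {zero}           {zero}           _ = refl
  f-inj {suc zero}       {suc zero}       _ = refl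
  f-inj {suc (suc zero)} {suc (suc zero)} _ = refl
  f-inj {zero}           {suc zero}       e = contradiction e x≢y
  f-inj {zero}           {suc (suc zero)} e = contradiction e x≢z
  f-inj {suc zero}       {suc (suc zero)} e = contradiction e y≢z
  f-inj {suc zero}       {zero}           e = contradiction (sym e) x≢y
  f-inj {suc (suc zero)} {zero}           e = contradiction (sym e) x≢z
  f-inj {suc (suc zero)} {suc zero}       e = contradiction (sym e) y≢z
  f-adj : ∀ i j → adj G (f i) (f j) ≡ adj H i j
  f-adj zero             zero             = trans (irrefl G x) (sym (irrefl H _))
  f-adj (suc zero)       (suc zero)       = trans (irrefl G y) (sym (irrefl H _))
  f-adj (suc (suc zero)) (suc (suc zero)) = trans (irrefl G z) (sym (irrefl H _))
  f-adj zero             (suc zero)       = xy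
  f-adj zero             (suc (suc zero)) = xz
  f-adj (suc zero)       (suc (suc zero)) = yz
  f-adj (suc zero)       zero             = trans (Graph.sym G y x) (trans xy (Graph.sym H _ _))
  f-adj (suc (suc zero)) zero             = trans (Graph.sym G z x) (trans xz (Graph.sym H _ _))
  f-adj (suc (suc zero)) (suc zero)       = trans (Graph.sym G z y) (trans yz (Graph.sym H _ _))

-- Dist is attained

AdjacencyCode : ℕ → Set
AdjacencyCode n = Vec (Vec Bool n) n

decode : AdjacencyCode n → Graph n
decode c = simpleGraph (λ i j → lookup (lookup c i) j ∧ lookup (lookup c j) i)
                       (λ i j → ∧-comm (lookup (lookup c i) j) _)

encode : Graph n → AdjacencyCode n
encode G = tabulate λ i → tabulate (adj G i)

decode∘encode : ∀ (G : Graph n) i j → adj (decode (encode G)) i j ≡ adj G i j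
decode∘encode G i j with i ≟ j
... | yes refl = sym (irrefl G i)
... | no _ rewrite lookup∘tabulate (tabulate ∘ adj G) i | lookup∘tabulate (tabulate ∘ adj G) j
                 | lookup∘tabulate (adj G i) j | lookup∘tabulate (adj G j) i | Graph.sym G j i = ∧-idem _

allCodes : ∀ n → List (AdjacencyCode n)
allCodes n = vectors (vectors (true ∷ false ∷ []) n) n

∈-allCodes : ∀ (c : AdjacencyCode n) → c ∈ allCodes n
∈-allCodes = ∈-vectors (∈-vectors λ { true → here refl ; false → there (here refl) })

symDiff-decode∘encode : ∀ (G F : Graph n) → symDiff G (decode (encode F)) ≡ symDiff G F
symDiff-decode∘encode {n} G F = trans
  (symDiff≡pairCount G (decode (encode F)) λ {i} {j} _ → cong (adj G i j xor_) (decode∘encode F i j))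
  (pairCount-allFin n _)

module _ {𝓗 : Graph n → Set} (𝓗? : ∀ G → Dec (𝓗 G)) (𝓗-closed : ∀ {G} → IsoToMember 𝓗 G → 𝓗 G)
  where

  DistIs-attained : ∀ (G G₀ : Graph n) → 𝓗 G₀ → ∃ λ e → DistIs G 𝓗 e × e ≤ symDiff G G₀
  DistIs-attained G G₀ G₀∈𝓗 = cost best , (attained , minimal) , best≤G₀
    where
    candidates : List (AdjacencyCode n)
    candidates = filter (𝓗? ∘ decode) (allCodes n)
    cost : AdjacencyCode n → ℕ
    cost c = symDiff G (decode c)
    best : AdjacencyCode n
    best = argmin cost (encode G₀) candidates
    decode∘encode-∈ : ∀ {F} → 𝓗 F → 𝓗 (decode (encode F))
    decode∘encode-∈ {F} F∈𝓗 = 𝓗-closed (F , F∈𝓗 , Permutation.id , decode∘encode F)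
    best∈𝓗 : 𝓗 (decode best)
    best∈𝓗 = argmin-all cost {encode G₀} {candidates} {P = 𝓗 ∘ decode}
                         (decode∘encode-∈ G₀∈𝓗) (all-filter (𝓗? ∘ decode) (allCodes n))
    attained : ∃ λ G' → IsoToMember 𝓗 G' × symDiff G G' ≡ cost best
    attained = decode best , (decode best , best∈𝓗 , Permutation.id , λ i j → refl) , refl
    minimal : ∀ G' → IsoToMember 𝓗 G' → cost best ≤ symDiff G G'
    minimal G' G'∈ = subst (cost best ≤_) (symDiff-decode∘encode G G')
      (All.lookup (f[argmin]≤f[xs] {f = cost} (encode G₀) candidates)
                  (∈-filter⁺ (𝓗? ∘ decode) (∈-allCodes (encode G'))
                             (decode∘encode-∈ (𝓗-closed {G'} G'∈))))
    best≤G₀ : cost best ≤ symDiff G G₀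
    best≤G₀ = subst (cost best ≤_) (symDiff-decode∘encode G G₀)
                    (f[argmin]≤f[⊤] {f = cost} (encode G₀) candidates)

  DistNIs-intro : ∀ {d} → (∀ G → ∃ λ G' → 𝓗 G' × symDiff G G' ≤ d) →
    (G₀ : Graph n) → (∀ G' → 𝓗 G' → d ≤ symDiff G₀ G') → DistNIs n 𝓗 d
  DistNIs-intro {d} upper G₀ lower = (G₀ , G₀-dist) , dist≤d
    where
    dist≤d : ∀ G → ∃ λ e → DistIs G 𝓗 e × e ≤ d
    dist≤d G with G' , G'∈𝓗 , G'≤d ← upper G
             with e , G-dist , e≤G' ← DistIs-attained G G' G'∈𝓗 = e , G-dist , ≤-trans e≤G' G'≤d
    G₀-dist : DistIs G₀ 𝓗 d
    G₀-dist with e , e-dist@((W , W∈ , W≡e) , _) , e≤d ← dist≤d G₀ =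
      subst (DistIs G₀ 𝓗) (≤-antisym e≤d (subst (d ≤_) W≡e (lower W (𝓗-closed W∈)))) e-dist

-- Upper bounds from 2-colourings

Upper : SmallH → ℕ → Set
Upper h n = ∀ (G : Graph n) → ∃ λ G' → Forb n (graphOf h) G' × symDiff G G' ≤ pairsWithinHalves n

-- φ a x y: whether a pair with adjacency a in G and endpoint colours x, y is edited.
colouringCost : (Bool → Bool → Bool → Bool) → (Fin n → Fin n → Bool) → (Fin n → Bool) → ℕ
colouringCost {n} φ a c = pairCount (λ i j → φ (a i j) (c i) (c j)) (allFin n)

OneSided : (Bool → Bool → Bool → Bool) → Set
OneSided φ = ∀ a x y → φ a x y ∧ φ a (not x) y ≡ false

Pairable : (Bool → Bool → Bool → Bool) → Set
Pairable φ = ∀ a → ∃ λ s → ∀ x → φ a x (x xor s) ≡ false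

bothColours-cost : ∀ φ → OneSided φ → ∀ (a c : Fin n → Bool) x →
  countᵇ (λ j → φ (a j) x (c j)) (allFin n) + countᵇ (λ j → φ (a j) (not x) (c j)) (allFin n) ≤ n
bothColours-cost {n} φ one-sided a c x =
  ≤-trans (countᵇ+countᵇ≤length {f = λ j → φ (a j) x (c j)} {g = λ j → φ (a j) (not x) (c j)}
                                (λ j → one-sided (a j) x (c j)) (allFin n))
          (≤-reflexive (length-tabulate id))

cheaperOfTwo : ∀ (f : Bool → ℕ) {k} → f true + f false ≤ k + k → ∃ λ x → f x ≤ k
cheaperOfTwo f {k} f-sum≤ with f true ≤? k
... | yes true≤k = true , true≤k
... | no  true≰k =
  false , +-cancelˡ-≤ k _ _ (≤-trans (+-monoˡ-≤ (f false) (<⇒≤ (≰⇒> true≰k))) f-sum≤)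

two-vertex-step : ∀ {n p p′ q q′ t} → p + p′ ≤ n → q + q′ ≤ n → t ≤ pairsWithinHalves n →
  (p + (q + t)) + (p′ + (q′ + t)) ≤ pairsWithinHalves (2 + n) + pairsWithinHalves (2 + n)
two-vertex-step {n} {p} {p′} {q} {q′} {t} p≤ q≤ t≤ = begin
  (p + (q + t)) + (p′ + (q′ + t))
    ≡⟨ regroup p q p′ q′ t ⟩
  (p + p′) + ((q + q′) + (t + t))
    ≤⟨ +-mono-≤ p≤ (+-mono-≤ q≤ (+-mono-≤ t≤ t≤)) ⟩
  n + (n + (pairsWithinHalves n + pairsWithinHalves n))
    ≡⟨ regroup′ n (pairsWithinHalves n) ⟩
  (n + pairsWithinHalves n) + (n + pairsWithinHalves n)
    ≡⟨ cong₂ _+_ (pairsWithinHalves-+2 n) (pairsWithinHalves-+2 n) ⟨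
  pairsWithinHalves (2 + n) + pairsWithinHalves (2 + n)
    ∎
  where
  open ≤-Reasoning
  regroup : ∀ p q p′ q′ t → (p + (q + t)) + (p′ + (q′ + t)) ≡ (p + p′) + ((q + q′) + (t + t))
  regroup = solve-∀
  regroup′ : ∀ n d → n + (n + (d + d)) ≡ (n + d) + (n + d)
  regroup′ = solve-∀

colouringCost-◂◂ : ∀ φ (a : Fin (2 + n) → Fin (2 + n) → Bool) x y (c : Fin n → Bool) →
  colouringCost φ a (x ◂ y ◂ c)
    ≡ [ φ (a zero (suc zero)) x y ] + countᵇ (λ j → φ (a zero (suc (suc j))) x (c j)) (allFin n)
      + (countᵇ (λ j → φ (a (suc zero) (suc (suc j))) y (c j)) (allFin n)
         + colouringCost φ (λ i j → a (suc (suc i)) (suc (suc j))) c)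
colouringCost-◂◂ {n} φ a x y c = trans (pairCount-allFin-suc pairCost)
  (cong₂ _+_ (countᵇ-allFin-suc (pairCost zero ∘ suc))
             (pairCount-allFin-suc (λ i j → pairCost (suc i) (suc j))))
  where
  pairCost : Fin (2 + n) → Fin (2 + n) → Bool
  pairCost i j = φ (a i j) ((x ◂ y ◂ c) i) ((x ◂ y ◂ c) j)

cheapColouring : ∀ φ → OneSided φ → Pairable φ → ∀ n (a : Fin n → Fin n → Bool) →
  ∃ λ c → colouringCost φ a c ≤ pairsWithinHalves n
cheapColouring φ one-sided pairable zero          a = (λ ()) , z≤n
cheapColouring φ one-sided pairable (suc zero)    a = (λ _ → true) , z≤n
cheapColouring φ one-sided pairable (suc (suc n)) a = Product.map colouring id (cheaperOfTwo cost cost-sum≤)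
  where
  a′ : Fin n → Fin n → Bool
  a′ i j = a (suc (suc i)) (suc (suc j))
  c′ : Fin n → Bool
  c′ = proj₁ (cheapColouring φ one-sided pairable n a′)
  t : ℕ
  t = colouringCost φ a′ c′
  t≤ : t ≤ pairsWithinHalves n
  t≤ = proj₂ (cheapColouring φ one-sided pairable n a′)
  s : Bool
  s = proj₁ (pairable (a zero (suc zero)))
  colouring : Bool → Fin (2 + n) → Bool
  colouring x = x ◂ (x xor s) ◂ c′
  cost row₀ row₁ : Bool → ℕ
  cost x = colouringCost φ a (colouring x)
  row₀ x = countᵇ (λ j → φ (a zero (suc (suc j))) x (c′ j)) (allFin n)
  row₁ x = countᵇ (λ j → φ (a (suc zero) (suc (suc j))) (x xor s) (c′ j)) (allFin n)
  cost≡ : ∀ x → cost x ≡ row₀ x + (row₁ x + t)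
  cost≡ x = trans (colouringCost-◂◂ φ a x (x xor s) c′)
                  (cong (λ b → [ b ] + row₀ x + (row₁ x + t)) (proj₂ (pairable (a zero (suc zero))) x))
  row₀-sum : row₀ true + row₀ false ≤ n
  row₀-sum = bothColours-cost φ one-sided (λ j → a zero (suc (suc j))) c′ true
  row₁-sum : row₁ true + row₁ false ≤ n
  row₁-sum = subst (_≤ n) (+-comm (row₁ false) _)
                   (bothColours-cost φ one-sided (λ j → a (suc zero) (suc (suc j))) c′ s)
  cost-sum≤ : cost true + cost false ≤ pairsWithinHalves (2 + n) + pairsWithinHalves (2 + n)
  cost-sum≤ rewrite cost≡ true | cost≡ false =
    two-vertex-step {p = row₀ true} {row₀ false} {row₁ true} {row₁ false} row₀-sum row₁-sum t≤

crossEdges : Graph n → (Fin n → Bool) → Graph n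
crossEdges G c = record
  { adj    = λ i j → adj G i j ∧ (c i xor c j)
  ; sym    = λ i j → cong₂ _∧_ (Graph.sym G i j) (xor-comm (c i) (c j))
  ; irrefl = λ i → cong (_∧ (c i xor c i)) (irrefl G i)
  }

crossEdges-K3-free : ∀ (G : Graph n) c → Forb n (graphOf K3) (crossEdges G c)
crossEdges-K3-free G c (f , _ , f-adj) =
  threeColours (c (f (# 0))) (c (f (# 1))) (c (f (# 2)))
               (xorPart (f-adj (# 0) (# 1))) (xorPart (f-adj (# 0) (# 2))) (xorPart (f-adj (# 1) (# 2)))
  where
  xorPart : ∀ {a b} → a ∧ b ≡ true → b ≡ true
  xorPart {true} b≡true = b≡true
  threeColours : ∀ x y z → x xor y ≡ true → x xor z ≡ true → y xor z ≡ true → ⊥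
  threeColours true  true  _     () _  _
  threeColours false false _     () _  _
  threeColours true  false true  _  () _
  threeColours false true  false _  () _
  threeColours true  false false _  _  ()
  threeColours false true  true  _  _  ()

edgeInsideClass : Bool → Bool → Bool → Bool
edgeInsideClass a x y = a ∧ not (x xor y)

symDiff-crossEdges : ∀ (G : Graph n) c →
  symDiff G (crossEdges G c) ≡ colouringCost edgeInsideClass (adj G) c
symDiff-crossEdges G c = symDiff≡pairCount G (crossEdges G c) λ {i} {j} _ → removed (adj G i j) (c i) (c j)
  where
  removed : ∀ a x y → a xor (a ∧ (x xor y)) ≡ a ∧ not (x xor y)
  removed false _     _     = refl
  removed true  true  true  = refl
  removed true  true  false = refl
  removed true  false true  = refl
  removed true  false false = refl

edgeInsideClass-oneSided : OneSided edgeInsideClass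
edgeInsideClass-oneSided false _     _     = refl
edgeInsideClass-oneSided true  true  true  = refl
edgeInsideClass-oneSided true  true  false = refl
edgeInsideClass-oneSided true  false true  = refl
edgeInsideClass-oneSided true  false false = refl

edgeInsideClass-pairable : Pairable edgeInsideClass
edgeInsideClass-pairable a = true , λ { true → ∧-zeroʳ a ; false → ∧-zeroʳ a }

K3-upper : Upper K3 n
K3-upper {n} G
  with c , cost≤ ← cheapColouring edgeInsideClass edgeInsideClass-oneSided
                                  edgeInsideClass-pairable n (adj G) =
  crossEdges G c , crossEdges-K3-free G c , subst (_≤ _) (sym (symDiff-crossEdges G c)) cost≤

twoCliques : (Fin n → Bool) → Graph n
twoCliques c = simpleGraph (λ i j → not (c i xor c j)) (λ i j → cong not (xor-comm (c i) (c j)))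

twoCliques-K12-free : ∀ (c : Fin n → Bool) → Forb n (graphOf K12) (twoCliques c)
twoCliques-K12-free c (f , f-inj , f-adj) =
  cherry (c (f (# 0))) (c (f (# 1))) (c (f (# 2)))
         (sameClass (f-adj (# 0) (# 1))) (sameClass (f-adj (# 0) (# 2)))
         (trans (sym (≢⇒≢ᵇ∧b≡b (1≢2 ∘ f-inj))) (f-adj (# 1) (# 2)))
  where
  1≢2 : ¬ (# 1 ≡ # 2)
  1≢2 ()
  sameClass : ∀ {a b} → a ∧ b ≡ true → b ≡ true
  sameClass {true} b≡true = b≡true
  cherry : ∀ x y z → not (x xor y) ≡ true → not (x xor z) ≡ true → not (y xor z) ≡ false → ⊥
  cherry true  true  true  _  _  ()
  cherry false false false _  _  ()
  cherry true  false _     () _  _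
  cherry false true  _     () _  _
  cherry true  true  false _  () _
  cherry false false true  _  () _

twoCliquesMismatch : Bool → Bool → Bool → Bool
twoCliquesMismatch a x y = a xor not (x xor y)

symDiff-twoCliques : ∀ (G : Graph n) c →
  symDiff G (twoCliques c) ≡ colouringCost twoCliquesMismatch (adj G) c
symDiff-twoCliques G c =
  symDiff≡pairCount G (twoCliques c) λ {i} {j} i≢j → cong (adj G i j xor_) (≢⇒≢ᵇ∧b≡b i≢j)

twoCliquesMismatch-oneSided : OneSided twoCliquesMismatch
twoCliquesMismatch-oneSided true  true  true  = refl
twoCliquesMismatch-oneSided true  true  false = refl
twoCliquesMismatch-oneSided true  false true  = refl
twoCliquesMismatch-oneSided true  false false = refl
twoCliquesMismatch-oneSided false true  true  = refl
twoCliquesMismatch-oneSided false true  false = refl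
twoCliquesMismatch-oneSided false false true  = refl
twoCliquesMismatch-oneSided false false false = refl

twoCliquesMismatch-pairable : Pairable twoCliquesMismatch
twoCliquesMismatch-pairable true  = false , λ { true → refl ; false → refl }
twoCliquesMismatch-pairable false = true  , λ { true → refl ; false → refl }

K12-upper : Upper K12 n
K12-upper {n} G
  with c , cost≤ ← cheapColouring twoCliquesMismatch twoCliquesMismatch-oneSided
                                  twoCliquesMismatch-pairable n (adj G) =
  twoCliques c , twoCliques-K12-free c , subst (_≤ _) (sym (symDiff-twoCliques G c)) cost≤

-- Lower bounds

Lower : SmallH → Graph n → Set
Lower {n} h G₀ = ∀ G' → Forb n (graphOf h) G' → pairsWithinHalves n ≤ symDiff G₀ G'

module _ (G : Graph n) (K3-free : Forb n (graphOf K3) G) where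

  triangleFree-coveringPair : ∀ {x y xs} → Unique (x ∷ y ∷ xs) →
    CoveringPair (λ i j → not (adj G i j)) (x ∷ y ∷ xs)
  triangleFree-coveringPair {x} {y} {xs} uniq
    with any? (λ u → any? (λ v → adj G u v Bool.≟ true) (x ∷ y ∷ xs)) (x ∷ y ∷ xs)
  ... | yes edge
    with u , u∈ , v-edge ← find edge
    with v , v∈ , uv ← find v-edge
    with rest , p ← ∈⇒↭∷∷ u∈ v∈ (adj≡true⇒≢ G uv)
    with (_ ∷ u≢rest) ∷ v≢rest ∷ _ ← Unique-resp-↭ p uniq
    = u , v , rest , p , All.zipWith noTriangle (u≢rest , v≢rest)
    where
    noTriangle : ∀ {j} → (u ≢ j × v ≢ j) → T (not (adj G u j) ∨ not (adj G v j))
    noTriangle {j} (u≢j , v≢j) with adj G u j in uj | adj G v j in vj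
    ... | false | _     = _
    ... | true  | false = _
    ... | true  | true  = K3-free (induced-triple G (graphOf K3) (adj≡true⇒≢ G uv) u≢j v≢j uv uj vj)
  ... | no edgeless = x , y , xs , ↭.refl , All.tabulate nonAdjacent
    where
    nonAdjacent : ∀ {j} → j ∈ xs → T (not (adj G x j) ∨ not (adj G y j))
    nonAdjacent {j} j∈ with adj G x j in xj
    ... | false = _
    ... | true  = ⊥-elim (edgeless (here (lose (there (there j∈)) xj)))

K3-lower : Lower K3 (completeGraph {n})
K3-lower {n} G K3-free = subst (pairsWithinHalves n ≤_) (sym symDiff≡nonEdges)
  (pairsWithinHalves≤pairCount (λ i j → cong not (Graph.sym G i j)) (triangleFree-coveringPair G K3-free)
                               n (length-tabulate id) (allFin⁺ n))
  where
  symDiff≡nonEdges : symDiff completeGraph G ≡ pairCount (λ i j → not (adj G i j)) (allFin n)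
  symDiff≡nonEdges =
    symDiff≡pairCount completeGraph G λ {i} {j} i≢j → cong (_xor adj G i j) (≢⇒≢ᵇ∧b≡b i≢j)

module _ (G : Graph n) (c : Fin n → Bool) where

  bipartiteMismatch : Fin n → Fin n → Bool
  bipartiteMismatch i j = (c i xor c j) xor adj G i j

  bipartiteMismatch-sym : Symmetricᵇ bipartiteMismatch
  bipartiteMismatch-sym i j = cong₂ _xor_ (xor-comm (c i) (c j)) (Graph.sym G i j)

  -- A peeled cross edge uv agrees with the bipartite graph, so it is not an edit;
  -- the ⊓ term pays for these, at most one per vertex of the smaller class.
  CrossBound : List (Fin n) → Set
  CrossBound xs = countᵇ c xs * countᵇ (not ∘ c) xs
                ≤ pairCount bipartiteMismatch xs + countᵇ c xs ⊓ countᵇ (not ∘ c) xs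

  noCrossEdge-bound : ∀ xs →
    (∀ {u v} → u ∈ xs → v ∈ xs → c u ≡ true → c v ≡ false → adj G u v ≡ false) → CrossBound xs
  noCrossEdge-bound xs noCrossEdge = begin
    countᵇ c xs * countᵇ (not ∘ c) xs   ≡⟨ pairCount-xor c xs ⟨
    pairCount (λ i j → c i xor c j) xs  ≤⟨ pairCount-mono xs crossPairMismatch ⟩
    pairCount bipartiteMismatch xs      ≤⟨ m≤m+n _ _ ⟩
    pairCount bipartiteMismatch xs + _  ∎
    where
    open ≤-Reasoning
    crossPairMismatch : ∀ {i j} → i ∈ xs → j ∈ xs → T (c i xor c j) → T (bipartiteMismatch i j)
    crossPairMismatch {i} {j} i∈ j∈ with c i in ci | c j in cj
    ... | true  | false rewrite noCrossEdge i∈ j∈ ci cj = _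
    ... | false | true  rewrite Graph.sym G i j | noCrossEdge j∈ i∈ cj ci = _

  crossEdge-step : ∀ {xs u v rest} → xs ↭ u ∷ v ∷ rest → c u ≡ true → c v ≡ false →
    All (λ j → T (bipartiteMismatch u j ∨ bipartiteMismatch v j)) rest → CrossBound rest → CrossBound xs
  crossEdge-step {xs} {u} {v} {rest} p cu cv covered bound = begin
    countᵇ c xs * countᵇ (not ∘ c) xs
      ≡⟨ cong₂ _*_ count-c count-notc ⟩
    suc a * suc b
      ≡⟨ suc*suc a b ⟩
    suc ((a + b) + a * b)
      ≤⟨ s≤s (+-mono-≤ (≤-reflexive (countᵇ+countᵇ-not c rest)) bound) ⟩
    suc (length rest + (P + a ⊓ b))
      ≡⟨ regroup (length rest) P (a ⊓ b) ⟩
    (length rest + P) + suc (a ⊓ b)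
      ≤⟨ +-monoˡ-≤ _ (pairCount-peel bipartiteMismatch-sym p covered) ⟩
    pairCount bipartiteMismatch xs + suc (a ⊓ b)
      ≡⟨ cong (pairCount bipartiteMismatch xs +_) (cong₂ _⊓_ count-c count-notc) ⟨
    pairCount bipartiteMismatch xs + countᵇ c xs ⊓ countᵇ (not ∘ c) xs
      ∎
    where
    open ≤-Reasoning
    a b P : ℕ
    a = countᵇ c rest
    b = countᵇ (not ∘ c) rest
    P = pairCount bipartiteMismatch rest
    count-c : countᵇ c xs ≡ suc a
    count-c = trans (countᵇ-↭ c p) (cong₂ (λ x y → [ x ] + ([ y ] + a)) cu cv)
    count-notc : countᵇ (not ∘ c) xs ≡ suc b
    count-notc = trans (countᵇ-↭ (not ∘ c) p) (cong₂ (λ x y → [ not x ] + ([ not y ] + b)) cu cv)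
    regroup : ∀ l p m → suc (l + (p + m)) ≡ (l + p) + suc m
    regroup = solve-∀

module _ (G : Graph n) (K12-free : Forb n (graphOf K12) G) where

  adj-twins : ∀ {u v j} → adj G u v ≡ true → u ≢ j → v ≢ j → adj G u j ≡ adj G v j
  adj-twins {u} {v} {j} uv u≢j v≢j with adj G u j in uj | adj G v j in vj
  ... | true  | true  = refl
  ... | false | false = refl
  ... | true  | false =
    ⊥-elim (K12-free (induced-triple G (graphOf K12) (adj≡true⇒≢ G uv) u≢j v≢j uv uj vj))
  ... | false | true  =
    ⊥-elim (K12-free (induced-triple G (graphOf K12) (adj≡true⇒≢ G vu) v≢j u≢j vu vj uj))
    where
    vu : adj G v u ≡ true
    vu = trans (Graph.sym G v u) uv

  crossBound : ∀ c k {xs} → length xs ≡ k → Unique xs → CrossBound G c xs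
  crossBound c zero       {[]}     _ _ = z≤n
  crossBound c (suc zero) {x ∷ []} _ _ with c x
  ... | true  = z≤n
  ... | false = z≤n
  crossBound c (suc (suc k)) {xs} len uniq
    with any? (λ u → (c u Bool.≟ true) ×-dec
                     any? (λ v → (c v Bool.≟ false) ×-dec (adj G u v Bool.≟ true)) xs) xs
  ... | no noCrossEdge = noCrossEdge-bound G c xs noCrossEdge′
    where
    noCrossEdge′ : ∀ {u v} → u ∈ xs → v ∈ xs → c u ≡ true → c v ≡ false → adj G u v ≡ false
    noCrossEdge′ {u} {v} u∈ v∈ cu cv with adj G u v in uv
    ... | false = refl
    ... | true  = ⊥-elim (noCrossEdge (lose u∈ (cu , lose v∈ (cv , uv))))
  ... | yes crossEdge
    with u , u∈ , cu , v-edge ← find crossEdge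
    with v , v∈ , cv , uv ← find v-edge
    with rest , p ← ∈⇒↭∷∷ u∈ v∈ (adj≡true⇒≢ G uv)
    with (_ ∷ u≢rest) ∷ v≢rest ∷ uniq-rest ← Unique-resp-↭ p uniq
    = crossEdge-step G c p cu cv (All.zipWith mismatchAtOne (u≢rest , v≢rest))
                     (crossBound c k len-rest uniq-rest)
    where
    len-rest : length rest ≡ k
    len-rest = suc-injective (suc-injective (trans (sym (↭-length p)) len))
    mismatchAtOne : ∀ {j} → (u ≢ j × v ≢ j) → T (bipartiteMismatch G c u j ∨ bipartiteMismatch G c v j)
    mismatchAtOne {j} (u≢j , v≢j) rewrite cu | cv | adj-twins uv u≢j v≢j with c j | adj G v j
    ... | true  | true  = _
    ... | true  | false = _
    ... | false | true  = _
    ... | false | false = _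

isEven : ℕ → Bool
isEven zero          = true
isEven (suc zero)    = false
isEven (suc (suc k)) = isEven k

evenClass : Fin n → Bool
evenClass i = isEven (toℕ i)

countᵇ-evenClass : ∀ n → countᵇ evenClass (allFin n) ≡ ⌈ n /2⌉
countᵇ-evenClass zero          = refl
countᵇ-evenClass (suc zero)    = refl
countᵇ-evenClass (suc (suc n)) = trans (countᵇ-allFin-suc (evenClass {2 + n}))
  (cong suc (trans (countᵇ-allFin-suc (evenClass {2 + n} ∘ suc)) (countᵇ-evenClass n)))

countᵇ-oddClass : ∀ n → countᵇ (not ∘ evenClass) (allFin n) ≡ ⌊ n /2⌋
countᵇ-oddClass zero          = refl
countᵇ-oddClass (suc zero)    = refl
countᵇ-oddClass (suc (suc n)) = trans (countᵇ-allFin-suc (not ∘ evenClass {2 + n}))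
  (trans (countᵇ-allFin-suc (not ∘ evenClass {2 + n} ∘ suc)) (cong suc (countᵇ-oddClass n)))

balancedCompleteBipartite : Graph n
balancedCompleteBipartite = record
  { adj    = λ i j → evenClass i xor evenClass j
  ; sym    = λ i j → xor-comm (evenClass i) (evenClass j)
  ; irrefl = λ i → xor-same (evenClass i)
  }

K12-lower : Lower K12 (balancedCompleteBipartite {n})
K12-lower {n} G K12-free = +-cancelʳ-≤ ⌊ n /2⌋ _ _ (begin
  pairsWithinHalves n + ⌊ n /2⌋
    ≡⟨ pairsWithinHalves+⌊n/2⌋ n ⟩
  ⌈ n /2⌉ * ⌊ n /2⌋
    ≡⟨ cong₂ _*_ (countᵇ-evenClass n) (countᵇ-oddClass n) ⟨
  countᵇ evenClass V * countᵇ (not ∘ evenClass) V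
    ≤⟨ crossBound G K12-free evenClass n (length-tabulate id) (allFin⁺ n) ⟩
  pairCount (bipartiteMismatch G evenClass) V + countᵇ evenClass V ⊓ countᵇ (not ∘ evenClass) V
    ≡⟨ cong₂ _+_ (symDiff≡pairCount balancedCompleteBipartite G λ _ → refl) (sym min≡⌊n/2⌋) ⟨
  symDiff balancedCompleteBipartite G + ⌊ n /2⌋
    ∎)
  where
  open ≤-Reasoning
  V : List (Fin n)
  V = allFin n
  min≡⌊n/2⌋ : countᵇ evenClass V ⊓ countᵇ (not ∘ evenClass) V ≡ ⌊ n /2⌋
  min≡⌊n/2⌋ = trans (cong₂ _⊓_ (countᵇ-evenClass n) (countᵇ-oddClass n)) (m≥n⇒m⊓n≡n (⌊n/2⌋≤⌈n/2⌉ n))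

-- Complementary patterns

dual : SmallH → SmallH
dual K3    = coK3
dual coK3  = K3
dual K12   = coK12
dual coK12 = K12

complement-graphOf : ∀ h i j → adj (complement (graphOf h)) i j ≡ adj (graphOf (dual h)) i j
complement-graphOf h = toWitness (byEvaluation h)
  where
  byEvaluation : ∀ h →
    True (all? λ i → all? λ j → adj (complement (graphOf h)) i j Bool.≟ adj (graphOf (dual h)) i j)
  byEvaluation K3    = _
  byEvaluation coK3  = _
  byEvaluation K12   = _
  byEvaluation coK12 = _

complement-Forb : ∀ h (G : Graph n) → Forb n (graphOf (dual h)) G → Forb n (graphOf h) (complement G)
complement-Forb h G G-free =
  G-free ∘ HasInduced-resp-≗ {G = G} {complement (graphOf h)} {graphOf (dual h)} (complement-graphOf h)
         ∘ complement-HasInduced {G = G} {graphOf h}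

dual-upper : ∀ h → Upper (dual h) n → Upper h n
dual-upper h upper G with G' , G'-free , G'≤ ← upper (complement G) =
  complement G' , complement-Forb h G' G'-free , subst (_≤ _) (sym (symDiff-complement G G')) G'≤

dual-lower : ∀ h {G₀ : Graph n} → Lower h G₀ → Lower (dual h) (complement G₀)
dual-lower h {G₀} lower G' G'-free =
  subst (_ ≤_) (symDiff-complement G₀ G') (lower (complement G') (complement-Forb h G' G'-free))

extremal : SmallH → Graph n
extremal K3    = completeGraph
extremal coK3  = complement completeGraph
extremal K12   = balancedCompleteBipartite
extremal coK12 = complement balancedCompleteBipartite

upper : ∀ h → Upper h n
upper K3    = K3-upper
upper coK3  = dual-upper coK3 K3-upper
upper K12   = K12-upper
upper coK12 = dual-upper coK12 K12-upper

lower : ∀ h → Lower h (extremal {n} h)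
lower K3    = K3-lower
lower coK3  = dual-lower K3 {completeGraph} K3-lower
lower K12   = K12-lower
lower coK12 = dual-lower K12 {balancedCompleteBipartite} K12-lower

theorem5p1 : (h : SmallH) (n : ℕ) → 1 ≤ n →
    DistNIs n (Forb n (graphOf h)) ((⌈ n /2⌉ C 2) + (⌊ n /2⌋ C 2))
theorem5p1 h n _ =
  DistNIs-intro (λ G → ¬? (hasInduced? G (graphOf h))) (λ {G} → Forb-closed {G = G} {graphOf h})
                (upper h) (extremal h) (lower h)
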